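{- Let $i,j,z \in \mathbb{N}$ and let $Y$ be any Young diagram with $z$ steps. Then: (i) if $z < \binom{i+j}{i}$, there exists an $(i,j)$-local partition of $Y$ into actual rectangles; (ii) if $z \geq \binom{i+j}{i}$, there exists no $(i,j)$-local cover of $Y$ with generalized rectangles.
   Context: For $x \in \mathbb{N}$ let $[x] = \{1,\ldots,x\}$. A Young diagram with $r$ rows and $c$ columns is a subset $Y \subseteq [r] \times [c]$ such that whenever $(i,j) \in Y$, then $(i-1,j) \in Y$ if $i \geq 2$ and $(i,j-1) \in Y$ if $j \geq 2$. The steps of $Y$ are the elements of $Z = \{(s,t) \in Y : (s+1,t) \notin Y \text{ and } (s,t+1) \notin Y\}$. A generalized rectangle in $Y$ is a set $R = S \times T$ with $S \subseteq [r]$, $T \subseteq [c]$ and $R \subseteq Y$; it uses the rows in $S$ and the columns in $T$. It is an actual rectangle if moreover $S$ is a set of consecutive integers and $T$ is a set of consecutive integers. A cover of $Y$ is a set $C$ of rectangles with $Y = \bigcup_{R \in C} R$; a partition is a cover whose rectangles are pairwise disjoint. A cover (or partition) $C$ is $(i,j)$-local if each row of $Y$ is used by at most $i$ rectangles of $C$ and each column of $Y$ is used by at most $j$ rectangles of $C$. -}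

module Defs where

open import Data.Nat using (ℕ; suc; _≤_; _<_; _≥_; _+_)
open import Data.Bool using (Bool; true; false; _∧_; not)
open import Data.List using (List; length; filterᵇ; map; upTo; cartesianProduct)
open import Data.List.Relation.Unary.Any using (Any)
open import Data.List.Relation.Unary.All using (All)
open import Data.List.Relation.Unary.AllPairs using (AllPairs)
open import Data.Product using (Σ; _×_; ∃₂; proj₁; proj₂)
open import Relation.Binary.PropositionalEquality using (_≡_)
open import Relation.Nullary using (¬_)
open import Function.Bundles using (_⇔_)

-- Conventions: rows/columns are 1-indexed natural numbers as in the paper;
-- subsets of ℕ (resp. ℕ × ℕ) are given by Bool-valued characteristic functions.

⟦_⟧ : ℕ → List ℕ
⟦ x ⟧ = map suc (upTo x)

record YoungDiagram (r c : ℕ) : Set where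
  field
    cell    : ℕ → ℕ → Bool
    bounded : ∀ s t → cell s t ≡ true → (1 ≤ s × s ≤ r) × (1 ≤ t × t ≤ c)
    down-row : ∀ s t → 1 ≤ s → cell (suc s) t ≡ true → cell s t ≡ true
    down-col : ∀ s t → 1 ≤ t → cell s (suc t) ≡ true → cell s t ≡ true

open YoungDiagram public

isStep : ∀ {r c} → YoungDiagram r c → ℕ × ℕ → Bool
isStep Y p = cell Y (proj₁ p) (proj₂ p)
           ∧ not (cell Y (suc (proj₁ p)) (proj₂ p))
           ∧ not (cell Y (proj₁ p) (suc (proj₂ p)))

-- number of steps of Y (Y ⊆ [r] × [c], so it suffices to count there)
numSteps : ∀ {r c} → YoungDiagram r c → ℕ
numSteps {r} {c} Y = length (filterᵇ (isStep Y) (cartesianProduct ⟦ r ⟧ ⟦ c ⟧))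

record Rect {r c : ℕ} (Y : YoungDiagram r c) : Set where
  field
    rows : ℕ → Bool
    cols : ℕ → Bool
    rows⊆ : ∀ s → rows s ≡ true → 1 ≤ s × s ≤ r
    cols⊆ : ∀ t → cols t ≡ true → 1 ≤ t × t ≤ c
    ⊆Y   : ∀ s t → rows s ≡ true → cols t ≡ true → cell Y s t ≡ true

open Rect public

_∈R_ : ∀ {r c} {Y : YoungDiagram r c} → ℕ × ℕ → Rect Y → Set
p ∈R R = (rows R (proj₁ p) ≡ true) × (cols R (proj₂ p) ≡ true)

Consecutive : (ℕ → Bool) → Set
Consecutive S = ∃₂ λ a b → ∀ s → (S s ≡ true) ⇔ (a ≤ s × s ≤ b)

Actual : ∀ {r c} {Y : YoungDiagram r c} → Rect Y → Set
Actual R = Consecutive (rows R) × Consecutive (cols R)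

Disjoint : ∀ {r c} {Y : YoungDiagram r c} → Rect Y → Rect Y → Set
Disjoint R R′ = ∀ p → ¬ (p ∈R R × p ∈R R′)

-- a (finite) family of rectangles of Y covers Y (each rectangle is ⊆ Y by definition)
IsCover : ∀ {r c} (Y : YoungDiagram r c) → List (Rect Y) → Set
IsCover Y C = ∀ s t → cell Y s t ≡ true → Any (λ R → (s , t) ∈R R) C
  where open import Data.Product using (_,_)

IsPartition : ∀ {r c} (Y : YoungDiagram r c) → List (Rect Y) → Set
IsPartition Y C = IsCover Y C × AllPairs Disjoint C

Local : ∀ {r c} {Y : YoungDiagram r c} → ℕ → ℕ → List (Rect Y) → Set
Local i j C = (∀ s → length (filterᵇ (λ R → rows R s) C) ≤ i)
            × (∀ t → length (filterᵇ (λ R → cols R t) C) ≤ j)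

-- List the z steps of Y by increasing row, so that their columns decrease. The cell in the row of
-- the a-th step and the column of the b-th step lies in Y exactly when a ≤ b, so an (i,j)-local cover
-- of Y yields an (i,j)-local cover of the triangle {(a,b) : a ≤ b < z} by rectangles contained in it.
-- For such a cover there is a cut k: the rows before k are each covered by a rectangle avoiding the
-- columns before k, and the columns after k by one avoiding the rows after k. Dropping those
-- rectangles leaves (i-1,j)- and (i,j-1)-local covers of the two smaller triangles, and Pascal's rule
-- gives z < C(i+j,i).
-- Conversely, if z < C(i+j,i), write the steps as S₁, σ, S₂ with |S₁| < C(i+j-1,i-1) and
-- |S₂| < C(i+j-1,i). The box from the corner to σ uses each row above σ and each column left of σ
-- once; the parts of Y right of it and below it are partitioned recursively, with one row use
-- resp. one column use fewer.

module Submission where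

open import Defs
open import Data.Bool using (Bool; true; false; _∧_; T)
open import Data.Bool.Properties using () renaming (_≟_ to _≟ᵇ_)
open import Data.Empty using (⊥; ⊥-elim)
open import Data.List using (List; []; _∷_; [_]; _++_; length; filterᵇ; cartesianProduct)
open import Data.List.Membership.Propositional using (_∈_; find; lose)
open import Data.List.Membership.Propositional.Properties
  using (∈-map⁺; ∈-upTo⁺; ∈-cartesianProduct⁺; ∈-cartesianProduct⁻; ∈-filter⁺)
open import Data.List.Relation.Unary.All using (All; []; _∷_; lookupAny)
import Data.List.Relation.Unary.All as All
import Data.List.Relation.Unary.All.Properties as All
open import Data.List.Relation.Unary.AllPairs using (AllPairs; []; _∷_)
import Data.List.Relation.Unary.AllPairs as AllPairs
import Data.List.Relation.Unary.AllPairs.Properties as AllPairs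
open import Data.List.Relation.Unary.Any using (Any; here; there)
import Data.List.Relation.Unary.Any as Any
open import Data.List.Relation.Unary.Any.Properties using (++⁺ˡ; ++⁺ʳ; ++⁻)
open import Data.Nat
  using (ℕ; zero; suc; _+_; _∸_; _≤_; _<_; _≥_; z≤n; s≤s; _≤?_; _<?_; _≤′_; ≤′-refl; ≤′-step)
open import Data.Nat.Combinatorics using (_C_; nCn≡1; nCk+nC[k+1]≡[n+1]C[k+1])
open import Data.Nat.Properties
open import Data.Product using (_×_; _,_; proj₁; proj₂; ∃)
open import Data.Product.Relation.Binary.Lex.Strict using (×-Lex)
open import Data.Sum using (_⊎_; inj₁; inj₂)
open import Function using (_∘_)
open import Function.Bundles using (_⇔_; mk⇔; Equivalence)
open import Relation.Binary.PropositionalEquality using (_≡_; refl; sym; trans; cong; subst)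
open import Relation.Nullary using (¬_; Dec; yes; no; does; ¬?; _×-dec_)
open import Relation.Nullary.Decidable using (dec-false; decidable-stable; T?)

count : {A : Set} → (A → Bool) → List A → ℕ
count f xs = length (filterᵇ f xs)

module _ {A : Set} (f : A → Bool) where

  count-pos : {xs : List A} → Any (λ x → f x ≡ true) xs → 0 < count f xs
  count-pos {x ∷ xs} (here fx) rewrite fx = s≤s z≤n
  count-pos {x ∷ xs} (there any) with f x
  ... | true  = s≤s z≤n
  ... | false = count-pos any

  count-mono : (g : A → Bool) → (∀ x → g x ≡ true → f x ≡ true) →
               ∀ xs → count g xs ≤ count f xs
  count-mono g g⇒f [] = z≤n
  count-mono g g⇒f (x ∷ xs) with g x in gx | f x in fx
  ... | true  | true  = s≤s (count-mono g g⇒f xs)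
  ... | true  | false with () ← trans (sym fx) (g⇒f x gx)
  ... | false | true  = m≤n⇒m≤1+n (count-mono g g⇒f xs)
  ... | false | false = count-mono g g⇒f xs

  count-mono-< : (g : A → Bool) → (∀ x → g x ≡ true → f x ≡ true) → ∀ {xs} →
                 Any (λ x → f x ≡ true × g x ≡ false) xs → count g xs < count f xs
  count-mono-< g g⇒f {x ∷ xs} (here (fx , gx)) rewrite fx | gx = s≤s (count-mono g g⇒f xs)
  count-mono-< g g⇒f {x ∷ xs} (there any) with g x in gx | f x in fx
  ... | true  | true  = s≤s (count-mono-< g g⇒f any)
  ... | true  | false with () ← trans (sym fx) (g⇒f x gx)
  ... | false | true  = m≤n⇒m≤1+n (count-mono-< g g⇒f any)
  ... | false | false = count-mono-< g g⇒f any

  count-++ : ∀ xs ys → count f (xs ++ ys) ≡ count f xs + count f ys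
  count-++ [] ys = refl
  count-++ (x ∷ xs) ys with f x
  ... | true  = cong suc (count-++ xs ys)
  ... | false = count-++ xs ys

  count-none : ∀ {xs} → All (λ x → f x ≡ false) xs → count f xs ≡ 0
  count-none [] = refl
  count-none (fx ∷ fxs) rewrite fx = count-none fxs

  count-[x]≤1 : ∀ x → count f [ x ] ≤ 1
  count-[x]≤1 x with f x
  ... | true  = s≤s z≤n
  ... | false = z≤n

  count-∷-++-≤ : ∀ {x xs ys a b c} → count f [ x ] ≤ a → count f xs ≤ b → count f ys ≤ c →
                 count f (x ∷ xs ++ ys) ≤ a + (b + c)
  count-∷-++-≤ {x} {xs} {ys} x≤a xs≤b ys≤c =
    subst (_≤ _) (sym (trans (count-++ [ x ] (xs ++ ys)) (cong (count f [ x ] +_) (count-++ xs ys))))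
          (+-mono-≤ x≤a (+-mono-≤ xs≤b ys≤c))

∧-true⁺ : ∀ {a b} → a ≡ true → b ≡ true → a ∧ b ≡ true
∧-true⁺ refl refl = refl

∧-true⁻ˡ : ∀ {a b} → a ∧ b ≡ true → a ≡ true
∧-true⁻ˡ {true} _ = refl

∧-false⁺ʳ : ∀ a {b} → b ≡ false → a ∧ b ≡ false
∧-false⁺ʳ true  refl = refl
∧-false⁺ʳ false refl = refl

does-true⇔ : ∀ {A : Set} (d : Dec A) → does d ≡ true ⇔ A
does-true⇔ (yes a) = mk⇔ (λ _ → a) (λ _ → refl)
does-true⇔ (no ¬a) = mk⇔ (λ ()) (λ a → ⊥-elim (¬a a))

true≢false : ∀ {b} → b ≡ true → b ≡ false → ⊥
true≢false refl ()

pascal : ℕ → ℕ → ℕ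
pascal zero    j       = 1
pascal (suc i) zero    = 1
pascal (suc i) (suc j) = pascal i (suc j) + pascal (suc i) j

pascal-pos : ∀ i j → 0 < pascal i j
pascal-pos zero    j       = s≤s z≤n
pascal-pos (suc i) zero    = s≤s z≤n
pascal-pos (suc i) (suc j) = ≤-trans (pascal-pos i (suc j)) (m≤m+n _ _)

pascal≡C : ∀ i j → pascal i j ≡ (i + j) C i
pascal≡C zero    j       = refl
pascal≡C (suc i) zero    rewrite +-identityʳ i = sym (nCn≡1 (suc i))
pascal≡C (suc i) (suc j) rewrite pascal≡C i (suc j) | pascal≡C (suc i) j | +-suc i j =
  nCk+nC[k+1]≡[n+1]C[k+1] (suc (i + j)) i

split-around : ∀ {A : Set} m n (x : A) xs → length (x ∷ xs) < m + n → 0 < m → 0 < n →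
               ∃ λ S₁ → ∃ λ σ → ∃ λ S₂ →
                 x ∷ xs ≡ S₁ ++ σ ∷ S₂ × length S₁ < m × length S₂ < n
split-around m n x [] _ 0<m 0<n = [] , x , [] , refl , 0<m , 0<n
split-around m n x (y ∷ ys) len 0<m 0<n with length (y ∷ ys) <? n
... | yes ys<n = [] , x , y ∷ ys , refl , 0<m , ys<n
split-around (suc zero) n x (y ∷ ys) (s≤s len) _ _ | no ys≮n = ⊥-elim (ys≮n len)
split-around (suc (suc m)) n x (y ∷ ys) (s≤s len) _ 0<n | no _
  with S₁ , σ , S₂ , eq , S₁<m , S₂<n ← split-around (suc m) n y ys len (s≤s z≤n) 0<n
  = x ∷ S₁ , σ , S₂ , cong (x ∷_) eq , s≤s S₁<m , S₂<n

AllPairs-++-∷⁻ : ∀ {A : Set} {R : A → A → Set} xs {y ys} → AllPairs R (xs ++ y ∷ ys) →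
                 AllPairs R xs × All (λ x → R x y) xs × All (R y) ys × AllPairs R ys
AllPairs-++-∷⁻ []       (y↝ys ∷ ys!) = [] , [] , y↝ys , ys!
AllPairs-++-∷⁻ (x ∷ xs) (x↝ ∷ rest) with xs! , xs↝y , y↝ys , ys! ← AllPairs-++-∷⁻ xs rest
                                     with x↝xs , x↝y ∷ _ ← All.++⁻ xs x↝
  = x↝xs ∷ xs! , x↝y ∷ xs↝y , y↝ys , ys!

last-true : ∀ (f : ℕ → Bool) B → (∀ x → f x ≡ true → x ≤ B) →
            ∀ {x} → f x ≡ true → ∃ λ x′ → x ≤ x′ × f x′ ≡ true × f (suc x′) ≡ false
last-true f B bounded {x} = climb B (m≤m+n B x)
  where
  climb : ∀ n {x} → B ≤ n + x → f x ≡ true → ∃ λ x′ → x ≤ x′ × f x′ ≡ true × f (suc x′) ≡ false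
  climb n {x} B≤ fx with f (suc x) in e
  ... | false = x , ≤-refl , fx , e
  climb zero    B≤ fx | true = ⊥-elim (<⇒≱ (bounded _ e) B≤)
  climb (suc n) {x} B≤ fx | true
    with x′ , x<x′ , fx′ , e′ ← climb n (subst (B ≤_) (sym (+-suc n x)) B≤) e
    = x′ , <⇒≤ x<x′ , fx′ , e′

nth : {A : Set} → A → List A → ℕ → A
nth d []       _       = d
nth d (x ∷ xs) zero    = x
nth d (x ∷ xs) (suc n) = nth d xs n

module _ {A : Set} {d : A} where

  All-nth : ∀ {P : A → Set} {xs n} → All P xs → n < length xs → P (nth d xs n)
  All-nth {n = zero}  (px ∷ _)   _         = px
  All-nth {n = suc n} (_  ∷ pxs) (s≤s n<) = All-nth pxs n<

  AllPairs-nth : ∀ {R : A → A → Set} {xs m n} → AllPairs R xs → m < n → n < length xs →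
                 R (nth d xs m) (nth d xs n)
  AllPairs-nth {m = zero}  {suc n} (x↝ ∷ _)   _         (s≤s n<) = All-nth x↝ n<
  AllPairs-nth {m = suc m} {suc n} (_  ∷ xs!) (s≤s m<n) (s≤s n<) = AllPairs-nth xs! m<n n<

AllPairs-refine : ∀ {A : Set} {P : A → Set} {R R′ : A → A → Set} {xs} →
                  (∀ {x y} → P x → P y → R x y → R′ x y) → All P xs → AllPairs R xs → AllPairs R′ xs
AllPairs-refine f []         []          = []
AllPairs-refine f (px ∷ pxs) (x↝ ∷ xs!) =
  All.zipWith (λ (py , r) → f px py r) (pxs , x↝) ∷ AllPairs-refine f pxs xs!

⟦⟧-sorted : ∀ n → AllPairs _<_ ⟦ n ⟧
⟦⟧-sorted n = AllPairs.map⁺ (AllPairs.applyUpTo⁺₁ (λ x → x) n (λ i<j _ → s≤s i<j))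

∈⟦⟧ : ∀ {n s} → 1 ≤ s → s ≤ n → s ∈ ⟦ n ⟧
∈⟦⟧ {s = suc s} _ s<n = ∈-map⁺ suc (∈-upTo⁺ s<n)

Lex : ℕ × ℕ → ℕ × ℕ → Set
Lex = ×-Lex _≡_ _<_ _<_

cartesianProduct-Lex : ∀ {xs ys : List ℕ} → AllPairs _<_ xs → AllPairs _<_ ys →
                       AllPairs Lex (cartesianProduct xs ys)
cartesianProduct-Lex {[]}     {ys} []          ys! = []
cartesianProduct-Lex {x ∷ xs} {ys} (x<xs ∷ xs!) ys! =
  AllPairs.++⁺ (AllPairs.map⁺ (AllPairs.map (λ y<y′ → inj₂ (refl , y<y′)) ys!))
               (cartesianProduct-Lex xs! ys!)
               (All.map⁺ (All.universal (λ _ → All.tabulate (λ τ∈ → inj₁ (first-larger τ∈))) ys))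
  where
  first-larger : ∀ {τ} → τ ∈ cartesianProduct xs ys → x < proj₁ τ
  first-larger τ∈ = All.lookup x<xs (proj₁ (∈-cartesianProduct⁻ xs ys τ∈))

-- The triangle bound

-- Rectangle x ∈ L has rows {a : p x a ≡ true} and columns {b : q x b ≡ true}.
record StaircaseCover {X : Set} (L : List X) (p q : X → ℕ → Bool) (z i j : ℕ) : Set where
  field
    covers    : ∀ a b → a ≤ b → b < z → Any (λ x → p x a ≡ true × q x b ≡ true) L
    upper     : ∀ x a b → a < z → b < z → p x a ≡ true → q x b ≡ true → a ≤ b
    row-local : ∀ a → a < z → count (λ x → p x a) L ≤ i
    col-local : ∀ b → b < z → count (λ x → q x b) L ≤ j

meets : (ℕ → Bool) → ℕ → Bool
meets f k = does (anyUpTo? (λ c → f c ≟ᵇ true) k)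

meets⇔ : ∀ f k → meets f k ≡ true ⇔ (∃ λ c → c < k × f c ≡ true)
meets⇔ f k = does-true⇔ (anyUpTo? (λ c → f c ≟ᵇ true) k)

meets⁺ : ∀ {f k c} → c < k → f c ≡ true → meets f k ≡ true
meets⁺ {f} {k} {c} c<k fc = Equivalence.from (meets⇔ f k) (c , c<k , fc)

meets-false : ∀ f k → ¬ (∃ λ c → c < k × f c ≡ true) → meets f k ≡ false
meets-false f k = dec-false (anyUpTo? (λ c → f c ≟ᵇ true) k)

shift-< : ∀ {k m a} → k ≤ m → a < m ∸ k → suc k + a < suc m
shift-< {k} k≤m a< = s≤s (subst (k + _ <_) (m+[n∸m]≡n k≤m) (+-monoʳ-< k a<))

module StaircaseSplit {X : Set} {L : List X} {p q : X → ℕ → Bool} {m i j : ℕ}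
                      (H : StaircaseCover L p q (suc m) (suc i) (suc j)) where
  open StaircaseCover H

  leftRows : ℕ → X → ℕ → Bool
  leftRows k x a = p x a ∧ meets (q x) k

  rightRows : ℕ → X → ℕ → Bool
  rightRows k x a = p x (suc k + a)

  rightCols : ℕ → X → ℕ → Bool
  rightCols k x b = q x (suc k + b) ∧ meets (rightRows k x) (m ∸ k)

  RowAvoids : ℕ → ℕ → Set
  RowAvoids k a = Any (λ x → p x a ≡ true × meets (q x) k ≡ false) L

  ColAvoids : ℕ → ℕ → Set
  ColAvoids k b = Any (λ x → q x (suc k + b) ≡ true × meets (rightRows k x) (m ∸ k) ≡ false) L

  rowAvoids? : ∀ k a → Dec (RowAvoids k a)
  rowAvoids? k a = Any.any? (λ x → (p x a ≟ᵇ true) ×-dec (meets (q x) k ≟ᵇ false)) L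

  left-cover : ∀ {k} → k ≤ m → (∀ a → a < k → RowAvoids k a) →
               StaircaseCover L (leftRows k) q k i (suc j)
  left-cover {k} k≤m avoid = record
    { covers    = λ a b a≤b b<k → Any.map (λ (pa , qb) → ∧-true⁺ pa (meets⁺ b<k qb) , qb)
                                          (covers a b a≤b (<z b<k))
    ; upper     = λ x a b a<k b<k pa qb → upper x a b (<z a<k) (<z b<k) (∧-true⁻ˡ pa) qb
    ; row-local = λ a a<k → ≤-pred (≤-trans
        (count-mono-< (λ x → p x a) (λ x → leftRows k x a) (λ _ → ∧-true⁻ˡ)
          (Any.map (λ {x} (pa , avoids) → pa , ∧-false⁺ʳ (p x a) avoids) (avoid a a<k)))
        (row-local a (<z a<k)))
    ; col-local = λ b b<k → col-local b (<z b<k)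
    }
    where
    <z : ∀ {a} → a < k → a < suc m
    <z a<k = ≤-trans a<k (m≤n⇒m≤1+n k≤m)

  right-cover : ∀ {k} → k ≤ m → (∀ b → b < m ∸ k → ColAvoids k b) →
                StaircaseCover L (rightRows k) (rightCols k) (m ∸ k) (suc i) j
  right-cover {k} k≤m avoid = record
    { covers    = λ a b a≤b b< →
        Any.map (λ (pa , qb) → pa , ∧-true⁺ qb (meets⁺ (≤-<-trans a≤b b<) pa))
                (covers (suc k + a) (suc k + b) (+-monoʳ-≤ (suc k) a≤b) (shift-< k≤m b<))
    ; upper     = λ x a b a< b< pa qb →
        +-cancelˡ-≤ (suc k) a b (upper x _ _ (shift-< k≤m a<) (shift-< k≤m b<) pa (∧-true⁻ˡ qb))
    ; row-local = λ a a< → row-local (suc k + a) (shift-< k≤m a<)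
    ; col-local = λ b b< → ≤-pred (≤-trans
        (count-mono-< (λ x → q x (suc k + b)) (λ x → rightCols k x b) (λ _ → ∧-true⁻ˡ)
          (Any.map (λ {x} (qb , avoids) → qb , ∧-false⁺ʳ (q x (suc k + b)) avoids) (avoid b b<)))
        (col-local (suc k + b) (shift-< k≤m b<)))
    }

  blocked⇒meets : ∀ {k a x} → ¬ RowAvoids k a → x ∈ L → p x a ≡ true → meets (q x) k ≡ true
  blocked⇒meets {k} {x = x} blocked x∈L pa with meets (q x) k in e
  ... | true  = refl
  ... | false = ⊥-elim (blocked (lose x∈L (pa , e)))

  -- Every rectangle through row a meets a column c ≤ k, so all its rows are ≤ c ≤ k.
  blocked-row⇒cols-avoid : ∀ {k a} → k ≤ m → a ≤ k → ¬ RowAvoids (suc k) a →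
                           ∀ b → b < m ∸ k → ColAvoids k b
  blocked-row⇒cols-avoid {k} {a} k≤m a≤k blocked b b<
    with x , x∈L , pa , qb ← find (covers a (suc k + b) (≤-trans a≤k (≤-trans (n≤1+n k) (m≤m+n (suc k) b)))
                                  (shift-< k≤m b<))
    with c , c≤k , qc ← Equivalence.to (meets⇔ (q x) (suc k)) (blocked⇒meets {suc k} blocked x∈L pa)
    = lose x∈L (qb , meets-false (rightRows k x) (m ∸ k) λ (a′ , a′< , pa′) →
        <⇒≱ (s≤s (≤-trans (≤-pred c≤k) (m≤m+n k a′)))
            (upper x _ c (shift-< k≤m a′<) (≤-trans c≤k (s≤s k≤m)) pa′ qc))

  -- Raise k while every row below it still avoids the columns below it; when this fails, or k reaches m,
  -- the columns above k avoid the rows above k.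
  split-point : ∃ λ k → k ≤ m × (∀ a → a < k → RowAvoids k a)
                            × (∀ b → b < m ∸ k → ColAvoids k b)
  split-point = search m 0 refl (λ _ ())
    where
    search : ∀ n k → k + n ≡ m → (∀ a → a < k → RowAvoids k a) →
             ∃ λ k → k ≤ m × (∀ a → a < k → RowAvoids k a) × (∀ b → b < m ∸ k → ColAvoids k b)
    search zero k k+0≡m rows = k , subst (k ≤_) k+0≡m (m≤m+n k 0) , rows , λ b b< →
      ⊥-elim (n≮0 (subst (b <_) (trans (cong (_∸ k) (sym k+0≡m)) (m+n∸m≡n k 0)) b<))
    search (suc n) k k+n≡m rows with anyUpTo? (λ a → ¬? (rowAvoids? (suc k) a)) (suc k)
    ... | yes (a , a<sk , blocked) = k , k≤m , rows , blocked-row⇒cols-avoid k≤m (≤-pred a<sk) blocked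
      where k≤m = subst (k ≤_) k+n≡m (m≤m+n k (suc n))
    ... | no none = search n (suc k) (trans (sym (+-suc k n)) k+n≡m) λ a a< →
      decidable-stable (rowAvoids? (suc k) a) λ ¬avoids → none (a , a< , ¬avoids)

staircaseCover-0<i×0<j : ∀ {X : Set} {L : List X} {p q m i j} →
                         StaircaseCover L p q (suc m) i j → 0 < i × 0 < j
staircaseCover-0<i×0<j H =
    ≤-trans (count-pos _ (Any.map proj₁ corner)) (row-local 0 (s≤s z≤n))
  , ≤-trans (count-pos _ (Any.map proj₂ corner)) (col-local 0 (s≤s z≤n))
  where
  open StaircaseCover H
  corner = covers 0 0 z≤n (s≤s z≤n)

staircase-bound : ∀ {X : Set} {L : List X} {p q} i j z → StaircaseCover L p q z i j → z < pascal i j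
staircase-bound i j zero H = pascal-pos i j
staircase-bound zero    j    (suc m) H with () ← proj₁ (staircaseCover-0<i×0<j H)
staircase-bound (suc i) zero (suc m) H with () ← proj₂ (staircaseCover-0<i×0<j H)
staircase-bound (suc i) (suc j) (suc m) H
  with k , k≤m , rows , cols ← StaircaseSplit.split-point H
  = subst (_≤ pascal i (suc j) + pascal (suc i) j) sizes
      (+-mono-≤ (staircase-bound i (suc j) k (StaircaseSplit.left-cover H k≤m rows))
                (staircase-bound (suc i) j (m ∸ k) (StaircaseSplit.right-cover H k≤m cols)))
  where
  sizes : suc k + suc (m ∸ k) ≡ suc (suc m)
  sizes = cong suc (trans (+-suc k (m ∸ k)) (cong suc (m+[n∸m]≡n k≤m)))

-- Box partitions of a staircase region

interval : ℕ → ℕ → ℕ → Bool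
interval lo hi n = does ((lo ≤? n) ×-dec (n ≤? hi))

interval⇔ : ∀ lo hi n → interval lo hi n ≡ true ⇔ (lo ≤ n × n ≤ hi)
interval⇔ lo hi n = does-true⇔ ((lo ≤? n) ×-dec (n ≤? hi))

interval⁺ : ∀ {lo hi n} → lo ≤ n → n ≤ hi → interval lo hi n ≡ true
interval⁺ {lo} {hi} {n} lo≤n n≤hi = Equivalence.from (interval⇔ lo hi n) (lo≤n , n≤hi)

interval⁻ : ∀ lo hi {n} → interval lo hi n ≡ true → lo ≤ n × n ≤ hi
interval⁻ lo hi {n} = Equivalence.to (interval⇔ lo hi n)

interval-below : ∀ lo hi {n} → n < lo → interval lo hi n ≡ false
interval-below lo hi {n} n<lo = dec-false ((lo ≤? n) ×-dec (n ≤? hi)) λ (lo≤n , _) → <⇒≱ n<lo lo≤n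

interval-above : ∀ lo hi {n} → hi < n → interval lo hi n ≡ false
interval-above lo hi {n} hi<n = dec-false ((lo ≤? n) ×-dec (n ≤? hi)) λ (_ , n≤hi) → <⇒≱ hi<n n≤hi

record Box : Set where
  constructor box
  field rowLo rowHi colLo colHi : ℕ

open Box

inRow : Box → ℕ → Bool
inRow b = interval (rowLo b) (rowHi b)

inCol : Box → ℕ → Bool
inCol b = interval (colLo b) (colHi b)

inRow⁻ : ∀ b {s} → inRow b s ≡ true → rowLo b ≤ s × s ≤ rowHi b
inRow⁻ b = interval⁻ (rowLo b) (rowHi b)

inCol⁻ : ∀ b {t} → inCol b t ≡ true → colLo b ≤ t × t ≤ colHi b
inCol⁻ b = interval⁻ (colLo b) (colHi b)

Apart : Box → Box → Set
Apart b b′ = rowHi b < rowLo b′ ⊎ rowHi b′ < rowLo b ⊎ colHi b < colLo b′ ⊎ colHi b′ < colLo b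

apart⇒disjoint : ∀ {b b′ s t} → Apart b b′ → inRow b s ≡ true → inCol b t ≡ true →
                 inRow b′ s ≡ true → inCol b′ t ≡ true → ⊥
apart⇒disjoint {b} {b′} (inj₁ hi<lo′) rs _ rs′ _ =
  <⇒≱ (≤-<-trans (proj₂ (inRow⁻ b rs)) hi<lo′) (proj₁ (inRow⁻ b′ rs′))
apart⇒disjoint {b} {b′} (inj₂ (inj₁ hi′<lo)) rs _ rs′ _ =
  <⇒≱ (≤-<-trans (proj₂ (inRow⁻ b′ rs′)) hi′<lo) (proj₁ (inRow⁻ b rs))
apart⇒disjoint {b} {b′} (inj₂ (inj₂ (inj₁ hi<lo′))) _ ct _ ct′ =
  <⇒≱ (≤-<-trans (proj₂ (inCol⁻ b ct)) hi<lo′) (proj₁ (inCol⁻ b′ ct′))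
apart⇒disjoint {b} {b′} (inj₂ (inj₂ (inj₂ hi′<lo))) _ ct _ ct′ =
  <⇒≱ (≤-<-trans (proj₂ (inCol⁻ b′ ct′)) hi′<lo) (proj₁ (inCol⁻ b ct))

-- Rows grow downwards, so the steps of a Young diagram form a chain for _↙_.
_↙_ : ℕ × ℕ → ℕ × ℕ → Set
(s , t) ↙ (s′ , t′) = s < s′ × t′ < t

Staircase : ℕ → ℕ → List (ℕ × ℕ) → Set
Staircase r₀ c₀ S = AllPairs _↙_ S × All (λ (s , t) → r₀ < s × c₀ < t) S

Below : List (ℕ × ℕ) → ℕ → ℕ → Set
Below S s t = Any (λ (s′ , t′) → s ≤ s′ × t ≤ t′) S

Inside : ℕ → ℕ → List (ℕ × ℕ) → Box → Set
Inside r₀ c₀ S b = r₀ < rowLo b × c₀ < colLo b × Below S (rowHi b) (colHi b)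

-- An (i,j)-local partition into boxes of the region of cells (s,t) with r₀ < s, c₀ < t lying below a step of S.
record BoxPartition (i j r₀ c₀ : ℕ) (S : List (ℕ × ℕ)) (L : List Box) : Set where
  field
    inside    : All (Inside r₀ c₀ S) L
    apart     : AllPairs Apart L
    row-local : ∀ s → count (λ b → inRow b s) L ≤ i
    col-local : ∀ t → count (λ b → inCol b t) L ≤ j
    covers    : ∀ s t → r₀ < s → c₀ < t → Below S s t →
                Any (λ b → inRow b s ≡ true × inCol b t ≡ true) L

module BoxCombine {i j r₀ c₀ s t : ℕ} {S₁ S₂ : List (ℕ × ℕ)} {L₁ L₂ : List Box}
  (S₁↙σ : All (_↙ (s , t)) S₁) (σ↙S₂ : All ((s , t) ↙_) S₂) (r₀<s : r₀ < s) (c₀<t : c₀ < t)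
  (P₁ : BoxPartition i (suc j) r₀ t S₁ L₁) (P₂ : BoxPartition (suc i) j s c₀ S₂ L₂) where

  private
    module P₁ = BoxPartition P₁
    module P₂ = BoxPartition P₂

  b₀ : Box
  b₀ = box (suc r₀) s (suc c₀) t

  right-of-b₀ : ∀ {b} → Inside r₀ t S₁ b → rowHi b < s × t < colLo b
  right-of-b₀ (_ , t<lo , below) with (lt , _) , (hi≤ , _) ← lookupAny S₁↙σ below =
    ≤-<-trans hi≤ lt , t<lo

  below-b₀ : ∀ {b} → Inside s c₀ S₂ b → s < rowLo b × colHi b < t
  below-b₀ (s<lo , _ , below) with (_ , lt) , (_ , hi≤) ← lookupAny σ↙S₂ below =
    s<lo , ≤-<-trans hi≤ lt

  S : List (ℕ × ℕ)
  S = S₁ ++ (s , t) ∷ S₂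

  inside : All (Inside r₀ c₀ S) (b₀ ∷ L₁ ++ L₂)
  inside = (n<1+n r₀ , n<1+n c₀ , ++⁺ʳ S₁ (here (≤-refl , ≤-refl)))
         ∷ All.++⁺ (All.map (λ (r₀< , t< , below) → r₀< , <-trans c₀<t t< , ++⁺ˡ below) P₁.inside)
                   (All.map (λ (s< , c₀< , below) → <-trans r₀<s s< , c₀< , ++⁺ʳ S₁ (there below))
                            P₂.inside)

  apart : AllPairs Apart (b₀ ∷ L₁ ++ L₂)
  apart = All.++⁺ (All.map (λ inside → inj₂ (inj₂ (inj₁ (proj₂ (right-of-b₀ inside))))) P₁.inside)
                  (All.map (λ inside → inj₁ (proj₁ (below-b₀ inside))) P₂.inside)
        ∷ AllPairs.++⁺ P₁.apart P₂.apart
            (All.map (λ inside₁ → All.map (λ inside₂ →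
                 inj₁ (<-trans (proj₁ (right-of-b₀ inside₁)) (proj₁ (below-b₀ inside₂)))) P₂.inside)
               P₁.inside)

  row-local : ∀ s′ → count (λ b → inRow b s′) (b₀ ∷ L₁ ++ L₂) ≤ suc i
  row-local s′ with s′ ≤? s
  ... | yes s′≤s = ≤-trans
    (count-∷-++-≤ (λ b → inRow b s′) {b₀} {L₁} {L₂}
      (count-[x]≤1 (λ b → inRow b s′) b₀) (P₁.row-local s′)
      (≤-reflexive (count-none (λ b → inRow b s′) L₂-misses)))
    (≤-reflexive (cong suc (+-identityʳ i)))
    where
    L₂-misses : All (λ b → inRow b s′ ≡ false) L₂
    L₂-misses = All.map (λ {b} inside → interval-below (rowLo b) (rowHi b)
                          (≤-<-trans s′≤s (proj₁ (below-b₀ inside)))) P₂.inside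
  ... | no s′≰s = count-∷-++-≤ (λ b → inRow b s′) {b₀} {L₁} {L₂}
      (≤-reflexive (count-none (λ b → inRow b s′) (interval-above (suc r₀) s (≰⇒> s′≰s) ∷ [])))
      (≤-reflexive (count-none (λ b → inRow b s′) L₁-misses)) (P₂.row-local s′)
    where
    L₁-misses : All (λ b → inRow b s′ ≡ false) L₁
    L₁-misses = All.map (λ {b} inside → interval-above (rowLo b) (rowHi b)
                          (<-trans (proj₁ (right-of-b₀ inside)) (≰⇒> s′≰s))) P₁.inside

  col-local : ∀ t′ → count (λ b → inCol b t′) (b₀ ∷ L₁ ++ L₂) ≤ suc j
  col-local t′ with t′ ≤? t
  ... | yes t′≤t = count-∷-++-≤ (λ b → inCol b t′) {b₀} {L₁} {L₂}
      (count-[x]≤1 (λ b → inCol b t′) b₀) (≤-reflexive (count-none (λ b → inCol b t′) L₁-misses))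
      (P₂.col-local t′)
    where
    L₁-misses : All (λ b → inCol b t′ ≡ false) L₁
    L₁-misses = All.map (λ {b} inside → interval-below (colLo b) (colHi b)
                          (≤-<-trans t′≤t (proj₂ (right-of-b₀ inside)))) P₁.inside
  ... | no t′≰t = ≤-trans
    (count-∷-++-≤ (λ b → inCol b t′) {b₀} {L₁} {L₂}
      (≤-reflexive (count-none (λ b → inCol b t′) (interval-above (suc c₀) t (≰⇒> t′≰t) ∷ [])))
      (P₁.col-local t′) (≤-reflexive (count-none (λ b → inCol b t′) L₂-misses)))
    (≤-reflexive (+-identityʳ (suc j)))
    where
    L₂-misses : All (λ b → inCol b t′ ≡ false) L₂
    L₂-misses = All.map (λ {b} inside → interval-above (colLo b) (colHi b)
                          (<-trans (proj₂ (below-b₀ inside)) (≰⇒> t′≰t))) P₂.inside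

  below-S₁ : ∀ {s′ t′} → Below S₁ s′ t′ → s′ < s
  below-S₁ below with (lt , _) , (s′≤ , _) ← lookupAny S₁↙σ below = ≤-<-trans s′≤ lt

  below-S₂ : ∀ {s′ t′} → Below S₂ s′ t′ → t′ < t
  below-S₂ below with (_ , lt) , (_ , t′≤) ← lookupAny σ↙S₂ below = ≤-<-trans t′≤ lt

  covers : ∀ s′ t′ → r₀ < s′ → c₀ < t′ → Below S s′ t′ →
           Any (λ b → inRow b s′ ≡ true × inCol b t′ ≡ true) (b₀ ∷ L₁ ++ L₂)
  covers s′ t′ r₀<s′ c₀<t′ below with s′ ≤? s | t′ ≤? t | ++⁻ S₁ below
  ... | yes s′≤s | yes t′≤t | _                      = here (interval⁺ r₀<s′ s′≤s , interval⁺ c₀<t′ t′≤t)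
  ... | _        | no t′≰t  | inj₁ below₁            = there (++⁺ˡ (P₁.covers s′ t′ r₀<s′ (≰⇒> t′≰t) below₁))
  ... | _        | no t′≰t  | inj₂ (here (_ , t′≤t)) = ⊥-elim (t′≰t t′≤t)
  ... | _        | no t′≰t  | inj₂ (there below₂)    = ⊥-elim (t′≰t (<⇒≤ (below-S₂ below₂)))
  ... | no s′≰s  | yes _    | inj₁ below₁            = ⊥-elim (s′≰s (<⇒≤ (below-S₁ below₁)))
  ... | no s′≰s  | yes _    | inj₂ (here (s′≤s , _)) = ⊥-elim (s′≰s s′≤s)
  ... | no s′≰s  | yes _    | inj₂ (there below₂)    = there (++⁺ʳ L₁ (P₂.covers s′ t′ (≰⇒> s′≰s) c₀<t′ below₂))

  combined : BoxPartition (suc i) (suc j) r₀ c₀ S (b₀ ∷ L₁ ++ L₂)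
  combined = record
    { inside = inside ; apart = apart ; row-local = row-local ; col-local = col-local ; covers = covers }

staircase-split : ∀ {r₀ c₀} S₁ {s t} S₂ → Staircase r₀ c₀ (S₁ ++ (s , t) ∷ S₂) →
                  All (_↙ (s , t)) S₁ × All ((s , t) ↙_) S₂ × r₀ < s × c₀ < t ×
                  Staircase r₀ t S₁ × Staircase s c₀ S₂
staircase-split S₁ S₂ (chain , bounds)
  with S₁! , S₁↙σ , σ↙S₂ , S₂! ← AllPairs-++-∷⁻ S₁ chain
  with bounds₁ , (r₀<s , c₀<t) ∷ bounds₂ ← All.++⁻ S₁ bounds
  = S₁↙σ , σ↙S₂ , r₀<s , c₀<t
  , (S₁! , All.zipWith (λ ((r₀< , _) , (_ , t<)) → r₀< , t<) (bounds₁ , S₁↙σ))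
  , (S₂! , All.zipWith (λ ((s< , _) , (_ , c₀<)) → s< , c₀<) (σ↙S₂ , bounds₂))

partition : ∀ i j r₀ c₀ S → Staircase r₀ c₀ S → length S < pascal i j →
            ∃ (BoxPartition i j r₀ c₀ S)
partition i j r₀ c₀ [] _ _ = [] , record
  { inside = [] ; apart = [] ; row-local = λ _ → z≤n ; col-local = λ _ → z≤n ; covers = λ _ _ _ _ () }
partition zero    j    r₀ c₀ (_ ∷ _) _ (s≤s ())
partition (suc i) zero r₀ c₀ (_ ∷ _) _ (s≤s ())
partition (suc i) (suc j) r₀ c₀ (x ∷ xs) stair len
  with S₁ , (s , t) , S₂ , eq , S₁< , S₂< ←
         split-around _ _ x xs len (pascal-pos i (suc j)) (pascal-pos (suc i) j)
  with S₁↙σ , σ↙S₂ , r₀<s , c₀<t , stair₁ , stair₂ ←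
         staircase-split S₁ S₂ (subst (Staircase r₀ c₀) eq stair)
  with L₁ , P₁ ← partition i (suc j) r₀ t S₁ stair₁ S₁<
  with L₂ , P₂ ← partition (suc i) j s c₀ S₂ stair₂ S₂<
  = box (suc r₀) s (suc c₀) t ∷ L₁ ++ L₂
  , subst (λ S → BoxPartition (suc i) (suc j) r₀ c₀ S (box (suc r₀) s (suc c₀) t ∷ L₁ ++ L₂)) (sym eq)
              (BoxCombine.combined S₁↙σ σ↙S₂ r₀<s c₀<t P₁ P₂)

-- Young diagrams

module Diagram {r c : ℕ} (Y : YoungDiagram r c) where

  cell-≤ : ∀ {s t s′ t′} → 1 ≤ s → 1 ≤ t → s ≤ s′ → t ≤ t′ →
           cell Y s′ t′ ≡ true → cell Y s t ≡ true
  cell-≤ {s} {t} 1≤s 1≤t s≤s′ t≤t′ e = up-rows (≤⇒≤′ s≤s′) (left-cols (≤⇒≤′ t≤t′) e)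
    where
    up-rows : ∀ {s′ t} → s ≤′ s′ → cell Y s′ t ≡ true → cell Y s t ≡ true
    up-rows ≤′-refl          e = e
    up-rows (≤′-step s≤s′) e = up-rows s≤s′ (down-row Y _ _ (≤-trans 1≤s (≤′⇒≤ s≤s′)) e)
    left-cols : ∀ {s′ t′} → t ≤′ t′ → cell Y s′ t′ ≡ true → cell Y s′ t ≡ true
    left-cols ≤′-refl          e = e
    left-cols (≤′-step t≤t′) e = left-cols t≤t′ (down-col Y _ _ (≤-trans 1≤t (≤′⇒≤ t≤t′)) e)

  cell-≥ : ∀ {s t s′ t′} → 1 ≤ s → 1 ≤ t → s ≤ s′ → t ≤ t′ →
           cell Y s t ≡ false → cell Y s′ t′ ≡ false
  cell-≥ {s′ = s′} {t′} 1≤s 1≤t s≤s′ t≤t′ e with cell Y s′ t′ in e′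
  ... | false = refl
  ... | true  = ⊥-elim (true≢false (cell-≤ 1≤s 1≤t s≤s′ t≤t′ e′) e)

  IsStep : ℕ × ℕ → Set
  IsStep (s , t) = cell Y s t ≡ true × cell Y (suc s) t ≡ false × cell Y s (suc t) ≡ false

  T-isStep⇒IsStep : ∀ {σ} → T (isStep Y σ) → IsStep σ
  T-isStep⇒IsStep {s , t} st with cell Y s t | cell Y (suc s) t | cell Y s (suc t)
  ... | true | false | false = refl , refl , refl

  IsStep⇒T-isStep : ∀ {σ} → IsStep σ → T (isStep Y σ)
  IsStep⇒T-isStep (e₁ , e₂ , e₃) rewrite e₁ | e₂ | e₃ = _

  module _ {σ : ℕ × ℕ} (σ-step : IsStep σ) where

    step-row-pos : 1 ≤ proj₁ σ
    step-row-pos = proj₁ (proj₁ (bounded Y _ _ (proj₁ σ-step)))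

    step-row-≤ : proj₁ σ ≤ r
    step-row-≤ = proj₂ (proj₁ (bounded Y _ _ (proj₁ σ-step)))

    step-col-pos : 1 ≤ proj₂ σ
    step-col-pos = proj₁ (proj₂ (bounded Y _ _ (proj₁ σ-step)))

    step-col-≤ : proj₂ σ ≤ c
    step-col-≤ = proj₂ (proj₂ (bounded Y _ _ (proj₁ σ-step)))

  steps : List (ℕ × ℕ)
  steps = filterᵇ (isStep Y) (cartesianProduct ⟦ r ⟧ ⟦ c ⟧)

  steps-are-steps : All IsStep steps
  steps-are-steps =
    All.map T-isStep⇒IsStep (All.all-filter (T? ∘ isStep Y) (cartesianProduct ⟦ r ⟧ ⟦ c ⟧))

  step∈steps : ∀ {σ} → IsStep σ → σ ∈ steps
  step∈steps st = ∈-filter⁺ (T? ∘ isStep Y)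
    (∈-cartesianProduct⁺ (∈⟦⟧ (step-row-pos st) (step-row-≤ st)) (∈⟦⟧ (step-col-pos st) (step-col-≤ st)))
    (IsStep⇒T-isStep st)

  Lex⇒↙ : ∀ {σ τ} → IsStep σ → IsStep τ → Lex σ τ → σ ↙ τ
  Lex⇒↙ {s , t} {s′ , t′} σ-step@(_ , down-empty , _) (e′ , _) (inj₁ s<s′) with t′ <? t
  ... | yes t′<t = s<s′ , t′<t
  ... | no  t′≮t =
    ⊥-elim (true≢false (cell-≤ (s≤s z≤n) (step-col-pos σ-step) s<s′ (≮⇒≥ t′≮t) e′) down-empty)
  Lex⇒↙ σ-step@(_ , _ , right-empty) (e′ , _) (inj₂ (refl , t<t′)) =
    ⊥-elim (true≢false (cell-≤ (step-row-pos σ-step) (s≤s z≤n) ≤-refl t<t′ e′) right-empty)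

  steps-staircase : Staircase 0 0 steps
  steps-staircase =
      AllPairs-refine Lex⇒↙ steps-are-steps
        (AllPairs.filter⁺ (T? ∘ isStep Y) (cartesianProduct-Lex (⟦⟧-sorted r) (⟦⟧-sorted c)))
    , All.map (λ st → step-row-pos st , step-col-pos st) steps-are-steps

  -- Walk right to the end of the row, then down to the end of the column.
  cell-below-step : ∀ {s t} → cell Y s t ≡ true → Below steps s t
  cell-below-step {s} {t} e
    with t′ , t≤t′ , e′ , right-empty ← last-true (cell Y s) c
                                                  (λ t′ e → proj₂ (proj₂ (bounded Y s t′ e))) e
    with s′ , s≤s′ , e″ , down-empty ← last-true (λ s′ → cell Y s′ t′) r
                                                 (λ s′ e → proj₂ (proj₁ (bounded Y s′ t′ e))) e′
    = lose (step∈steps (e″ , down-empty , cell-≥ 1≤s (s≤s z≤n) s≤s′ ≤-refl right-empty)) (s≤s′ , t≤t′)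
    where
    1≤s = proj₁ (proj₁ (bounded Y s t e))

  -- (0 , 0) is a junk default: only indices below numSteps Y = length steps are ever used.
  row col : ℕ → ℕ
  row a = proj₁ (nth (0 , 0) steps a)
  col b = proj₂ (nth (0 , 0) steps b)

  nth-step : ∀ {a} → a < numSteps Y → IsStep (row a , col a)
  nth-step = All-nth steps-are-steps

  nth-↙ : ∀ {a b} → a < b → b < numSteps Y → (row a , col a) ↙ (row b , col b)
  nth-↙ = AllPairs-nth (proj₁ steps-staircase)

  upper-cell : ∀ {a b} → a ≤ b → b < numSteps Y → cell Y (row a) (col b) ≡ true
  upper-cell {a} {b} a≤b b<z with m≤n⇒m<n∨m≡n a≤b
  ... | inj₂ refl = proj₁ (nth-step b<z)
  ... | inj₁ a<b  = cell-≤ (step-row-pos (nth-step (<-trans a<b b<z))) (step-col-pos (nth-step b<z))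
                          (<⇒≤ (proj₁ (nth-↙ a<b b<z))) ≤-refl (proj₁ (nth-step b<z))

  lower-empty : ∀ {a b} → b < a → a < numSteps Y → cell Y (row a) (col b) ≡ false
  lower-empty b<a a<z with _ , down-empty , _ ← nth-step (<-trans b<a a<z) =
    cell-≥ (s≤s z≤n) (step-col-pos (nth-step (<-trans b<a a<z))) (proj₁ (nth-↙ b<a a<z)) ≤-refl down-empty

  cover⇒staircaseCover : ∀ {i j P} → IsCover Y P → Local i j P →
    StaircaseCover P (λ R a → rows R (row a)) (λ R b → cols R (col b)) (numSteps Y) i j
  cover⇒staircaseCover cover (row-local , col-local) = record
    { covers    = λ a b a≤b b<z → cover (row a) (col b) (upper-cell a≤b b<z)
    ; upper     = λ R a b a<z _ ra cb → ≮⇒≥ λ b<a → true≢false (⊆Y R _ _ ra cb) (lower-empty b<a a<z)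
    ; row-local = λ a _ → row-local (row a)
    ; col-local = λ b _ → col-local (col b)
    }

  no-local-cover : ∀ {i j} → numSteps Y ≥ pascal i j → ¬ (∃ λ P → IsCover Y P × Local i j P)
  no-local-cover {i} {j} z≥ (P , cover , local) =
    <⇒≱ (staircase-bound i j _ (cover⇒staircaseCover cover local)) z≥

  toRect : (b : Box) → Inside 0 0 steps b → Rect Y
  toRect b (0<lo , 0<lo′ , below) with τ , τ∈ , hi≤ , hi′≤ ← find below = record
    { rows  = inRow b
    ; cols  = inCol b
    ; rows⊆ = λ s e → proj₁ (row-range e) , ≤-trans (proj₂ (row-range e)) (step-row-≤ τ-step)
    ; cols⊆ = λ t e → proj₁ (col-range e) , ≤-trans (proj₂ (col-range e)) (step-col-≤ τ-step)
    ; ⊆Y    = λ s t es et → cell-≤ (proj₁ (row-range es)) (proj₁ (col-range et))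
                                   (proj₂ (row-range es)) (proj₂ (col-range et)) (proj₁ τ-step)
    }
    where
    τ-step = All.lookup steps-are-steps τ∈
    row-range : ∀ {s} → inRow b s ≡ true → 1 ≤ s × s ≤ proj₁ τ
    row-range e = ≤-trans 0<lo (proj₁ (inRow⁻ b e)) , ≤-trans (proj₂ (inRow⁻ b e)) hi≤
    col-range : ∀ {t} → inCol b t ≡ true → 1 ≤ t × t ≤ proj₂ τ
    col-range e = ≤-trans 0<lo′ (proj₁ (inCol⁻ b e)) , ≤-trans (proj₂ (inCol⁻ b e)) hi′≤

  rectangles : (L : List Box) → All (Inside 0 0 steps) L → List (Rect Y)
  rectangles []      []         = []
  rectangles (b ∷ L) (ib ∷ iL) = toRect b ib ∷ rectangles L iL

  rectangles-actual : ∀ {L} (inside : All (Inside 0 0 steps) L) → All Actual (rectangles L inside)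
  rectangles-actual {[]}    []          = []
  rectangles-actual {b ∷ L} (ib ∷ iL) =
    ((rowLo b , rowHi b , interval⇔ _ _) , (colLo b , colHi b , interval⇔ _ _)) ∷ rectangles-actual iL

  count-rectangles : ∀ (f : Rect Y → Bool) (g : Box → Bool) → (∀ b ib → f (toRect b ib) ≡ g b) →
                     ∀ {L} (inside : All (Inside 0 0 steps) L) → count f (rectangles L inside) ≡ count g L
  count-rectangles f g f≡g {[]}    []          = refl
  count-rectangles f g f≡g {b ∷ L} (ib ∷ iL) rewrite f≡g b ib with g b
  ... | true  = cong suc (count-rectangles f g f≡g iL)
  ... | false = count-rectangles f g f≡g iL

  rectangles-cover : ∀ {L s t} (inside : All (Inside 0 0 steps) L) →
                     Any (λ b → inRow b s ≡ true × inCol b t ≡ true) L →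
                     Any ((s , t) ∈R_) (rectangles L inside)
  rectangles-cover (ib ∷ iL) (here st)  = here st
  rectangles-cover (ib ∷ iL) (there st) = there (rectangles-cover iL st)

  rectangles-disjoint : ∀ {L} (inside : All (Inside 0 0 steps) L) → AllPairs Apart L →
                        AllPairs Disjoint (rectangles L inside)
  rectangles-disjoint []          []                  = []
  rectangles-disjoint (ib ∷ iL) (b-apart ∷ L-apart) = disjoint-from b-apart iL ∷ rectangles-disjoint iL L-apart
    where
    disjoint-from : ∀ {L} → All (Apart _) L → (iL : All (Inside 0 0 steps) L) →
                    All (Disjoint (toRect _ ib)) (rectangles L iL)
    disjoint-from []                 []          = []
    disjoint-from (apart ∷ apart-L) (ib′ ∷ iL) =
      (λ _ ((rs , ct) , (rs′ , ct′)) → apart⇒disjoint apart rs ct rs′ ct′) ∷ disjoint-from apart-L iL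

  partition⇒rectangles : ∀ {i j L} → BoxPartition i j 0 0 steps L →
                         ∃ λ P → All Actual P × IsPartition Y P × Local i j P
  partition⇒rectangles {i} {j} P = rectangles _ inside , rectangles-actual inside
    , ((λ s t e → rectangles-cover inside
         (covers s t (proj₁ (proj₁ (bounded Y s t e))) (proj₁ (proj₂ (bounded Y s t e))) (cell-below-step e)))
      , rectangles-disjoint inside apart)
    , (λ s → subst (_≤ i) (sym (count-rectangles _ (λ b → inRow b s) (λ _ _ → refl) inside)) (row-local s))
    , (λ t → subst (_≤ j) (sym (count-rectangles _ (λ b → inCol b t) (λ _ _ → refl) inside)) (col-local t))
    where open BoxPartition P

  local-partition : ∀ {i j} → numSteps Y < pascal i j →
                    ∃ λ P → All Actual P × IsPartition Y P × Local i j P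
  local-partition {i} {j} z< = partition⇒rectangles (proj₂ (partition i j 0 0 steps steps-staircase z<))

theorem3 : (i j r c : ℕ) (Y : YoungDiagram r c) →
    (numSteps Y < (i + j) C i →
      ∃ λ (P : List (Rect Y)) → All Actual P × IsPartition Y P × Local i j P)
    × (numSteps Y ≥ (i + j) C i →
      ¬ (∃ λ (P : List (Rect Y)) → IsCover Y P × Local i j P))
theorem3 i j r c Y rewrite sym (pascal≡C i j) = local-partition , no-local-cover
  where open Diagram Y
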